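{- Work in Incomprehensive Set Theory (defined in the context). If $x$ is a lower, then $x^{++}\neq x$.
   Context: Incomprehensive Set Theory is the first-order theory in the language $\{\in,=\}$ whose only axioms are: Existence of Successor, $\forall x\,\exists! y\,\forall z\,(z\in y \iff z\in x \lor z=x)$; and Existence of Predecessor, $\forall x\,\exists! y\,\forall z\,(z\in y\iff z\in x\wedge z\neq x)$. The unique $y$ in the first axiom is written $x^{++}$. An object $x$ is a lower if $\forall z\in x,\ z\notin z$. -}

module Defs where

open import Level using (Level; suc; _⊔_)
open import Data.Product using (Σ; _×_; proj₁)
open import Data.Sum using (_⊎_)
open import Relation.Nullary using (¬_)
open import Relation.Binary.PropositionalEquality using (_≡_)
open import Function.Bundles using (_⇔_)

∃! : ∀ {a p} {A : Set a} → (A → Set p) → Set (a ⊔ p)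
∃! {A = A} P = Σ A (λ y → P y × (∀ y′ → P y′ → y ≡ y′))

-- A model of Incomprehensive Set Theory: a domain with a membership
-- relation (equality is the identity of the domain), satisfying
-- Existence of Successor and Existence of Predecessor.
record IST (a ℓ : Level) : Set (suc (a ⊔ ℓ)) where
  field
    U   : Set a
    _∈_ : U → U → Set ℓ
    successor   : ∀ x → ∃! (λ y → ∀ z → (z ∈ y) ⇔ ((z ∈ x) ⊎ (z ≡ x)))
    predecessor : ∀ x → ∃! (λ y → ∀ z → (z ∈ y) ⇔ ((z ∈ x) × ¬ (z ≡ x)))

  _⁺⁺ : U → U
  x ⁺⁺ = proj₁ (successor x)

  Lower : U → Set (a ⊔ ℓ)
  Lower x = ∀ z → z ∈ x → ¬ (z ∈ z)

{-# OPTIONS --safe #-}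
module Submission where

open import Defs
open import Level using (Level)
open import Relation.Nullary using (¬_)
open import Relation.Binary.PropositionalEquality using (_≡_; refl; subst)
open import Data.Product using (proj₁; proj₂)
open import Data.Sum using (inj₂)
open import Function.Bundles using (Equivalence)

module _ {a ℓ : Level} (M : IST a ℓ) where
  open IST M

  ∈-⁺⁺ : ∀ x → x ∈ (x ⁺⁺)
  ∈-⁺⁺ x = Equivalence.from (proj₁ (proj₂ (successor x)) x) (inj₂ refl)

  ⁺⁺-fixed⇒∈-self : ∀ {x} → x ⁺⁺ ≡ x → x ∈ x
  ⁺⁺-fixed⇒∈-self {x} eq = subst (x ∈_) eq (∈-⁺⁺ x)

lemma4p1 : ∀ {a ℓ} (M : IST a ℓ) → let open IST M in
    ∀ x → Lower x → ¬ (x ⁺⁺ ≡ x)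
lemma4p1 M x lower eq = lower x (⁺⁺-fixed⇒∈-self M eq) (⁺⁺-fixed⇒∈-self M eq)
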